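{- Let $G$ be a connected graph of order $n\geqslant 3$ which is not a cycle. For every integer $k\geqslant 2$, $D(G^{\frac{1}{k+1}})\leqslant D'(G^{\frac{1}{k}})$.
   Context: Graphs are finite and simple. The $k$-subdivision $G^{\frac{1}{k}}$ is obtained by replacing each edge $uv$ of $G$ by a path of length $k$ between $u$ and $v$ with $k-1$ new internal vertices. The distinguishing number $D(H)$ (resp. index $D'(H)$) is the least $d$ such that some labeling $V(H)\to\{1,\dots,d\}$ (resp. $E(H)\to\{1,\dots,d\}$) is preserved by no non-trivial automorphism of $H$. -}

module Defs where

open import Data.Nat using (ℕ; zero; suc; _∸_; _≤_)
open import Data.Fin using (Fin; toℕ; _<_)
open import Data.Bool using (Bool; true; false; T)
open import Data.Product using (Σ; ∃; _×_; _,_; proj₁; proj₂)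
open import Data.Sum using (_⊎_)
open import Relation.Binary.PropositionalEquality using (_≡_; _≢_)
open import Function using (_⇔_; Bijective)

record SimpleGraph (n : ℕ) : Set where
  field
    adj    : Fin n → Fin n → Bool
    sym    : ∀ u v → adj u v ≡ adj v u
    irrefl : ∀ u → adj u u ≡ false
open SimpleGraph public

record Graph : Set₁ where
  field
    V   : Set
    Adj : V → V → Set
open Graph public

data Walk {n : ℕ} (G : SimpleGraph n) : Fin n → Fin n → Set where
  here : ∀ {u} → Walk G u u
  step : ∀ {u v w} → T (adj G u v) → Walk G v w → Walk G u w

Connected : ∀ {n} → SimpleGraph n → Set
Connected {n} G = ∀ (u v : Fin n) → Walk G u v

CycSucc : ∀ {n} → Fin n → Fin n → Set
CycSucc {n} i j = toℕ j ≡ suc (toℕ i) ⊎ (suc (toℕ i) ≡ n × toℕ j ≡ 0)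

CycAdj : ∀ {n} → Fin n → Fin n → Set
CycAdj i j = CycSucc i j ⊎ CycSucc j i

IsCycle : ∀ {n} → SimpleGraph n → Set
IsCycle {n} G =
  Σ (Fin n → Fin n) λ f → Bijective _≡_ _≡_ f ×
    (∀ i j → (T (adj G (f i) (f j)) ⇔ CycAdj i j))

-- k-subdivision G^{1/k} (for k ≥ 1): the edge {u,v} with u < v gets internal
-- vertices (u,v,i), i = 0..k-2, forming the path u - (u,v,0) - ... - (u,v,k-2) - v.
Internal : ∀ {n} → SimpleGraph n → ℕ → Set
Internal {n} G k =
  Σ (Fin n) λ u → Σ (Fin n) λ v → (T (adj G u v) × u < v) × Fin (k ∸ 1)

iu : ∀ {n} (G : SimpleGraph n) (k : ℕ) → Internal G k → Fin n
iu _ _ (u , _ , _ , _) = u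

iv : ∀ {n} (G : SimpleGraph n) (k : ℕ) → Internal G k → Fin n
iv _ _ (_ , v , _ , _) = v

ii : ∀ {n} (G : SimpleGraph n) (k : ℕ) → Internal G k → ℕ
ii _ _ (_ , _ , _ , i) = toℕ i

data SubAdj {n : ℕ} (G : SimpleGraph n) (k : ℕ) :
            Fin n ⊎ Internal G k → Fin n ⊎ Internal G k → Set where
  orig     : ∀ {a b} → k ≡ 1 → T (adj G a b) → SubAdj G k (Data.Sum.inj₁ a) (Data.Sum.inj₁ b)
  startL   : ∀ {a x} → a ≡ iu G k x → ii G k x ≡ 0 → SubAdj G k (Data.Sum.inj₁ a) (Data.Sum.inj₂ x)
  startR   : ∀ {a x} → a ≡ iu G k x → ii G k x ≡ 0 → SubAdj G k (Data.Sum.inj₂ x) (Data.Sum.inj₁ a)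
  endL     : ∀ {a x} → a ≡ iv G k x → suc (ii G k x) ≡ k ∸ 1 → SubAdj G k (Data.Sum.inj₁ a) (Data.Sum.inj₂ x)
  endR     : ∀ {a x} → a ≡ iv G k x → suc (ii G k x) ≡ k ∸ 1 → SubAdj G k (Data.Sum.inj₂ x) (Data.Sum.inj₁ a)
  inner    : ∀ {x y} → iu G k x ≡ iu G k y → iv G k x ≡ iv G k y →
             (suc (ii G k x) ≡ ii G k y ⊎ suc (ii G k y) ≡ ii G k x) →
             SubAdj G k (Data.Sum.inj₂ x) (Data.Sum.inj₂ y)

Subdivision : ∀ {n} → SimpleGraph n → ℕ → Graph
Subdivision {n} G k = record { V = Fin n ⊎ Internal G k ; Adj = SubAdj G k }

IsAut : (H : Graph) → (V H → V H) → Set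
IsAut H σ = Bijective _≡_ _≡_ σ × (∀ x y → (Adj H x y ⇔ Adj H (σ x) (σ y)))

IsDistVertexLabeling : (H : Graph) (d : ℕ) → (V H → Fin d) → Set
IsDistVertexLabeling H d ℓ =
  ∀ σ → IsAut H σ → (∀ x → ℓ (σ x) ≡ ℓ x) → ∀ x → σ x ≡ x

-- edge labeling: a labeling of unordered adjacent pairs, represented by a
-- function on ordered pairs that is symmetric on edges (values on non-edges
-- are irrelevant).
IsEdgeLabeling : (H : Graph) (d : ℕ) → (V H → V H → Fin d) → Set
IsEdgeLabeling H d ℓ = ∀ x y → Adj H x y → ℓ x y ≡ ℓ y x

IsDistEdgeLabeling : (H : Graph) (d : ℕ) → (V H → V H → Fin d) → Set
IsDistEdgeLabeling H d ℓ =
  IsEdgeLabeling H d ℓ ×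
  (∀ σ → IsAut H σ → (∀ x y → Adj H x y → ℓ (σ x) (σ y) ≡ ℓ x y) → ∀ x → σ x ≡ x)

VertexDistinguishable : Graph → ℕ → Set
VertexDistinguishable H d = Σ (V H → Fin d) (IsDistVertexLabeling H d)

EdgeDistinguishable : Graph → ℕ → Set
EdgeDistinguishable H d = Σ (V H → V H → Fin d) (IsDistEdgeLabeling H d)

IsDistinguishingNumber : Graph → ℕ → Set
IsDistinguishingNumber H d =
  VertexDistinguishable H d × (∀ d′ → VertexDistinguishable H d′ → d ≤ d′)

IsDistinguishingIndex : Graph → ℕ → Set
IsDistinguishingIndex H d =
  EdgeDistinguishable H d × (∀ d′ → EdgeDistinguishable H d′ → d ≤ d′)

module Submission where

-- Colour the i-th internal vertex of the path that replaces an edge uv in G^{1/(k+1)} by the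
-- colour, under a distinguishing edge labelling ℓ of G^{1/k}, of the i-th edge of the path that
-- replaces uv there, and give all original vertices one common colour. Let σ be an automorphism of
-- G^{1/(k+1)} preserving this colouring. Interior vertices of the paths have degree two, so σ
-- carries paths onto paths; hence if σ sends one original vertex to an original vertex, by
-- connectivity it does so for all, and σ is induced by an automorphism π of G. The automorphism of
-- G^{1/k} induced by π then preserves ℓ, so it is trivial, and so are π and σ. Otherwise σ sends
-- every original vertex to an internal one, so every vertex of G has degree two and G, being
-- connected, is a cycle.

open import Defs hiding (sym)
open import Data.Bool using (Bool; true; false; T; not)
open import Data.Bool.Properties using (T-irrelevant)
open import Data.Empty using (⊥-elim)
open import Data.Fin as Fin using (Fin; toℕ; fromℕ<)
open import Data.Fin.Properties using (toℕ-injective; toℕ-fromℕ<; fromℕ<-toℕ; toℕ<n; _≟_; _<?_; any?; pigeonhole)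
open import Data.Nat using (ℕ; zero; suc; _∸_; _≤_; _<_; z≤n; s≤s; _≤?_)
  renaming (_<?_ to _<ℕ?_)
open import Data.Nat.Properties
  using (≤-refl; ≤-trans; ≤-antisym; ≤-pred; <⇒≤; <-irrefl; <-asym; <-cmp; <-irrelevant; ≰⇒>; ≤∧≢⇒<;
         n≤1+n; m≢1+n+m; +-∸-assoc; n∸n≡0; m∸[m∸n]≡n; m∸n≤m; ∸-cancelˡ-≡)
open import Data.Product using (∃; Σ-syntax; _×_; _,_; proj₁; proj₂)
open import Data.Sum using (_⊎_; inj₁; inj₂)
open import Data.Sum.Properties using (inj₁-injective)
open import Function using (mk⇔)
open import Function.Bundles using (Equivalence)
open import Relation.Binary.Definitions using (tri<; tri≈; tri>)
open import Relation.Binary.PropositionalEquality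
  using (_≡_; _≢_; refl; sym; trans; cong; cong₂; subst; subst₂; module ≡-Reasoning)
open import Relation.Nullary using (¬_; Dec; yes; no)

record DegreeTwo {V : Set} (_~_ : V → V → Set) (x : V) : Set where
  field
    nb₁ nb₂    : V
    nb₁≢nb₂    : nb₁ ≢ nb₂
    ~nb₁       : x ~ nb₁
    ~nb₂       : x ~ nb₂
    neighbours : ∀ w → x ~ w → w ≡ nb₁ ⊎ w ≡ nb₂

DegreeTwo-reflect : ∀ (H : Graph) {σ} → IsAut H σ → ∀ x → DegreeTwo (Adj H) (σ x) → DegreeTwo (Adj H) x
DegreeTwo-reflect H {σ} ((σ-injective , σ-surjective) , σ-adj) x deg = record
  { nb₁        = pre nb₁
  ; nb₂        = pre nb₂
  ; nb₁≢nb₂    = λ eq → nb₁≢nb₂ (trans (sym (σ-pre nb₁)) (trans (cong σ eq) (σ-pre nb₂)))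
  ; ~nb₁       = reflect (subst (Adj H (σ x)) (sym (σ-pre nb₁)) ~nb₁)
  ; ~nb₂       = reflect (subst (Adj H (σ x)) (sym (σ-pre nb₂)) ~nb₂)
  ; neighbours = λ w x~w → Data.Sum.map (λ eq → σ-injective (trans eq (sym (σ-pre nb₁))))
                                          (λ eq → σ-injective (trans eq (sym (σ-pre nb₂))))
                                          (neighbours (σ w) (Equivalence.to (σ-adj x w) x~w))
  }
  where
  open DegreeTwo deg
  pre : V H → V H
  pre y = proj₁ (σ-surjective y)
  σ-pre : ∀ y → σ (pre y) ≡ y
  σ-pre y = proj₂ (σ-surjective y) refl
  reflect : ∀ {y} → Adj H (σ x) (σ y) → Adj H x y
  reflect {y} = Equivalence.from (σ-adj x y)

least-below : ∀ {P : ℕ → Set} → (∀ j → Dec (P j)) → ∀ N →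
              (∀ {c′} → c′ < N → ¬ P c′) ⊎ (Σ[ c ∈ ℕ ] c < N × P c × (∀ {c′} → c′ < c → ¬ P c′))
least-below P? zero = inj₁ λ ()
least-below {P} P? (suc N) with least-below P? N
... | inj₂ (c , c<N , pc , least) = inj₂ (c , ≤-trans c<N (n≤1+n N) , pc , least)
... | inj₁ none with P? N
...   | yes pN = inj₂ (N , ≤-refl , pN , none)
...   | no ¬pN = inj₁ none′
  where
  none′ : ∀ {c′} → c′ < suc N → ¬ P c′
  none′ {c′} c′≤N with <-cmp c′ N
  ... | tri< c′<N _ _ = none c′<N
  ... | tri≈ _ refl _ = ¬pN
  ... | tri> _ _ N<c′ = ⊥-elim (<-irrefl refl (≤-trans (s≤s N<c′) c′≤N))

least-witness : ∀ {P : ℕ → Set} → (∀ j → Dec (P j)) → ∀ {j} → P j →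
                Σ[ c ∈ ℕ ] c ≤ j × P c × (∀ {c′} → c′ < c → ¬ P c′)
least-witness P? {j} pj with least-below P? (suc j)
... | inj₁ none                   = ⊥-elim (none ≤-refl pj)
... | inj₂ (c , c≤j , pc , least) = c , ≤-pred c≤j , pc , least

∸-suc : ∀ {a b} → b < a → a ∸ b ≡ suc (a ∸ suc b)
∸-suc = +-∸-assoc 1

module Adjacency {n : ℕ} (G : SimpleGraph n) where

  infix 4 _~_
  _~_ : Fin n → Fin n → Set
  a ~ b = T (adj G a b)

  ~-sym : ∀ {a b} → a ~ b → b ~ a
  ~-sym {a} {b} = subst T (SimpleGraph.sym G a b)

  ~⇒≢ : ∀ {a b} → a ~ b → a ≢ b
  ~⇒≢ {a} a~a refl = subst T (irrefl G a) a~a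

  Edge : Set
  Edge = Σ[ u ∈ Fin n ] Σ[ v ∈ Fin n ] u ~ v × u Fin.< v

  edge-irrelevant : ∀ {u v} (p p′ : u ~ v × u Fin.< v) → p ≡ p′
  edge-irrelevant (h , l) (h′ , l′) = cong₂ _,_ (T-irrelevant h h′) (<-irrelevant l l′)

  Arc : Set
  Arc = Edge × Bool

  start end : Arc → Fin n
  start ((u , v , _) , true)  = u
  start ((u , v , _) , false) = v
  end   ((u , v , _) , true)  = v
  end   ((u , v , _) , false) = u

  start~end : ∀ O → start O ~ end O
  start~end ((_ , _ , u~v , _) , true)  = u~v
  start~end ((_ , _ , u~v , _) , false) = ~-sym u~v

  flip : Arc → Arc
  flip (e , b) = e , not b

  start-flip : ∀ O → start (flip O) ≡ end O
  start-flip (_ , true)  = refl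
  start-flip (_ , false) = refl

  end-flip : ∀ O → end (flip O) ≡ start O
  end-flip (_ , true)  = refl
  end-flip (_ , false) = refl

  Arc-≡ : ∀ O O′ → start O ≡ start O′ → end O ≡ end O′ → O ≡ O′
  Arc-≡ ((u , v , p) , true)  ((_ , _ , p′) , true)  refl refl = cong (λ p → (u , v , p) , true) (edge-irrelevant p p′)
  Arc-≡ ((u , v , p) , false) ((_ , _ , p′) , false) refl refl = cong (λ p → (u , v , p) , false) (edge-irrelevant p p′)
  Arc-≡ ((_ , _ , _ , u<v) , true)  ((_ , _ , _ , v<u) , false) refl refl = ⊥-elim (<-asym u<v v<u)
  Arc-≡ ((_ , _ , _ , v<u) , false) ((_ , _ , _ , u<v) , true)  refl refl = ⊥-elim (<-asym u<v v<u)

  orient : ∀ a b → a ~ b → Arc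
  orient a b a~b with a <? b
  ... | yes a<b = (a , b , a~b , a<b) , true
  ... | no  a≮b = (b , a , ~-sym a~b , b<a) , false
    where
    b<a : b Fin.< a
    b<a = ≤∧≢⇒< (≤-pred (≰⇒> a≮b)) (λ b≡a → ~⇒≢ a~b (toℕ-injective (sym b≡a)))

  orient-start : ∀ a b (a~b : a ~ b) → start (orient a b a~b) ≡ a
  orient-start a b a~b with a <? b
  ... | yes _ = refl
  ... | no  _ = refl

  orient-end : ∀ a b (a~b : a ~ b) → end (orient a b a~b) ≡ b
  orient-end a b a~b with a <? b
  ... | yes _ = refl
  ... | no  _ = refl

record Automorphism {n : ℕ} (G : SimpleGraph n) : Set where
  open Adjacency G
  field
    to from  : Fin n → Fin n
    to-adj   : ∀ {a b} → a ~ b → to a ~ to b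
    from-adj : ∀ {a b} → a ~ b → from a ~ from b
    from∘to  : ∀ w → from (to w) ≡ w
    to∘from  : ∀ w → to (from w) ≡ w

module TwoRegular {n : ℕ} (G : SimpleGraph n) (connected : Connected G)
                  (two-regular : ∀ r → DegreeTwo (Adjacency._~_ G) r) (a₀ : Fin n) where
  open Adjacency G
  open DegreeTwo

  other : Fin n → Fin n → Fin n
  other x y with y ≟ nb₁ (two-regular x)
  ... | yes _ = nb₂ (two-regular x)
  ... | no _  = nb₁ (two-regular x)

  ~other : ∀ x y → x ~ other x y
  ~other x y with y ≟ nb₁ (two-regular x)
  ... | yes _ = ~nb₂ (two-regular x)
  ... | no _  = ~nb₁ (two-regular x)

  other≢ : ∀ x y → other x y ≢ y
  other≢ x y with y ≟ nb₁ (two-regular x)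
  ... | yes y≡nb₁ = λ nb₂≡y → nb₁≢nb₂ (two-regular x) (trans (sym y≡nb₁) (sym nb₂≡y))
  ... | no y≢nb₁  = λ nb₁≡y → y≢nb₁ (sym nb₁≡y)

  other-neighbours : ∀ {x y} → x ~ y → ∀ w → x ~ w → w ≡ y ⊎ w ≡ other x y
  other-neighbours {x} {y} x~y w x~w with y ≟ nb₁ (two-regular x)
                                     | neighbours (two-regular x) y x~y
                                     | neighbours (two-regular x) w x~w
  ... | yes y≡nb₁ | _         | inj₁ w≡nb₁ = inj₁ (trans w≡nb₁ (sym y≡nb₁))
  ... | yes _     | _         | inj₂ w≡nb₂ = inj₂ w≡nb₂
  ... | no y≢nb₁  | inj₁ y≡nb₁ | _         = ⊥-elim (y≢nb₁ y≡nb₁)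
  ... | no _      | inj₂ _    | inj₁ w≡nb₁ = inj₂ w≡nb₁
  ... | no _      | inj₂ y≡nb₂ | inj₂ w≡nb₂ = inj₁ (trans w≡nb₂ (sym y≡nb₂))

  walk : ℕ → Fin n
  walk zero             = a₀
  walk (suc zero)       = nb₁ (two-regular a₀)
  walk (suc (suc t))    = other (walk (suc t)) (walk t)

  walk-adj : ∀ t → walk t ~ walk (suc t)
  walk-adj zero    = ~nb₁ (two-regular a₀)
  walk-adj (suc t) = ~other (walk (suc t)) (walk t)

  walk-nonbacktracking : ∀ t → walk (suc (suc t)) ≢ walk t
  walk-nonbacktracking t = other≢ (walk (suc t)) (walk t)

  walk-neighbours : ∀ t w → walk (suc t) ~ w → w ≡ walk t ⊎ w ≡ walk (suc (suc t))
  walk-neighbours t = other-neighbours (~-sym (walk-adj t))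

  return-length : ∀ j → walk (suc j) ≡ a₀ → 2 ≤ j
  return-length zero          eq = ⊥-elim (~⇒≢ (walk-adj 0) (sym eq))
  return-length (suc zero)    eq = ⊥-elim (walk-nonbacktracking 0 eq)
  return-length (suc (suc _)) _  = s≤s (s≤s z≤n)

  Revisits : ℕ → Set
  Revisits j = Σ[ i ∈ Fin j ] walk (toℕ i) ≡ walk j

  first-revisit : Σ[ c ∈ ℕ ] c ≤ n × Revisits c × (∀ {c′} → c′ < c → ¬ Revisits c′)
  first-revisit with pigeonhole ≤-refl (λ (i : Fin (suc n)) → walk (toℕ i))
  ... | i , j , i<j , eq with least-witness (λ j → any? (λ i → walk (toℕ i) ≟ walk j))
                                            (fromℕ< i<j , trans (cong walk (toℕ-fromℕ< i<j)) eq)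
  ...   | c , c≤j , revisit , first = c , ≤-trans c≤j (≤-pred (toℕ<n j)) , revisit , first

  module FirstRevisit (c′ : ℕ) (c≤n : suc c′ ≤ n) (revisit : Revisits (suc c′))
                      (first : ∀ {j} → j < suc c′ → ¬ Revisits j) where

    walk-injective : ∀ {a b} → a < suc c′ → b < suc c′ → walk a ≡ walk b → a ≡ b
    walk-injective {a} {b} a<c b<c eq with <-cmp a b
    ... | tri< a<b _ _ = ⊥-elim (first b<c (fromℕ< a<b , trans (cong walk (toℕ-fromℕ< a<b)) eq))
    ... | tri≈ _ a≡b _ = a≡b
    ... | tri> _ _ b<a = ⊥-elim (first a<c (fromℕ< b<a , trans (cong walk (toℕ-fromℕ< b<a)) (sym eq)))

    returns-to-start : walk (suc c′) ≡ a₀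
    returns-to-start = revisit-is-start (proj₁ revisit) (proj₂ revisit)
      where
      revisit-is-start : ∀ (i : Fin (suc c′)) → walk (toℕ i) ≡ walk (suc c′) → walk (suc c′) ≡ a₀
      revisit-is-start i eq with toℕ i | toℕ<n i
      ... | zero   | _   = sym eq
      ... | suc i′ | i<c with walk-neighbours i′ (walk c′) (subst (_~ walk c′) (sym eq) (~-sym (walk-adj c′)))
      ...   | inj₁ eq′ =
        ⊥-elim (<-irrefl (walk-injective (≤-trans (≤-pred i<c) (n≤1+n c′)) ≤-refl (sym eq′)) (≤-pred i<c))
      ...   | inj₂ eq′ with <-cmp (suc (suc i′)) c′
      ...     | tri< i′+2<c′ _ _ =
        ⊥-elim (<-irrefl (sym (walk-injective ≤-refl (≤-trans i′+2<c′ (n≤1+n c′)) eq′)) i′+2<c′)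
      ...     | tri≈ _ refl _    = ⊥-elim (walk-nonbacktracking (suc i′) (sym eq))
      ...     | tri> _ _ c′<i′+2 = ⊥-elim (~⇒≢ (walk-adj c′) (trans (cong walk c′≡i′+1) eq))
        where
        c′≡i′+1 : c′ ≡ suc i′
        c′≡i′+1 = ≤-antisym (≤-pred c′<i′+2) (≤-pred i<c)

    3≤c : 3 ≤ suc c′
    3≤c = s≤s (return-length c′ returns-to-start)

    1<c : 1 < suc c′
    1<c = ≤-trans (n≤1+n 2) 3≤c

    walk-last : nb₂ (two-regular a₀) ≡ walk c′
    walk-last with neighbours (two-regular a₀) (walk c′) (subst (_~ walk c′) returns-to-start (~-sym (walk-adj c′)))
    ... | inj₁ eq = ⊥-elim (<-irrefl (sym (walk-injective ≤-refl 1<c eq)) (≤-pred 3≤c))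
    ... | inj₂ eq = sym eq

    CycleStep : ℕ → ℕ → Set
    CycleStep t u = u ≡ suc t ⊎ (suc t ≡ suc c′ × u ≡ 0)

    cycleStep-adj : ∀ {t u} → CycleStep t u → walk t ~ walk u
    cycleStep-adj {t} (inj₁ refl)         = walk-adj t
    cycleStep-adj {t} (inj₂ (refl , refl)) = subst (walk t ~_) returns-to-start (walk-adj t)

    walk-neighbour : ∀ {t w} → t < suc c′ → walk t ~ w →
                     Σ[ u ∈ ℕ ] u < suc c′ × walk u ≡ w × (CycleStep t u ⊎ CycleStep u t)
    walk-neighbour {zero} _ a₀~w with neighbours (two-regular a₀) _ a₀~w
    ... | inj₁ eq = 1 , 1<c , sym eq , inj₁ (inj₁ refl)
    ... | inj₂ eq = c′ , ≤-refl , sym (trans eq walk-last) , inj₂ (inj₂ (refl , refl))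
    walk-neighbour {suc t} t<c w~ with walk-neighbours t _ w~
    ... | inj₁ eq = t , ≤-trans (n≤1+n _) t<c , sym eq , inj₂ (inj₁ refl)
    ... | inj₂ eq with suc (suc t) <ℕ? suc c′
    ...   | yes t+2<c = suc (suc t) , t+2<c , sym eq , inj₁ (inj₁ refl)
    ...   | no  t+2≮c =
      0 , s≤s z≤n , sym (trans eq (trans (cong walk t+2≡c) returns-to-start)) , inj₁ (inj₂ (t+2≡c , refl))
      where
      t+2≡c : suc (suc t) ≡ suc c′
      t+2≡c = ≤-antisym t<c (≤-pred (≰⇒> t+2≮c))

    OnWalk : Fin n → Set
    OnWalk w = Σ[ t ∈ ℕ ] t < suc c′ × walk t ≡ w

    walk-reaches : ∀ {u w} → Walk G u w → OnWalk u → OnWalk w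
    walk-reaches here                 on = on
    walk-reaches (step u~v path) (t , t<c , refl) with walk-neighbour t<c u~v
    ... | s , s<c , eq , _ = walk-reaches path (s , s<c , eq)

    on-walk : ∀ w → OnWalk w
    on-walk w = walk-reaches (connected a₀ w) (0 , s≤s z≤n , refl)

    index : Fin n → Fin (suc c′)
    index w = fromℕ< (proj₁ (proj₂ (on-walk w)))

    walk-index : ∀ w → walk (toℕ (index w)) ≡ w
    walk-index w with on-walk w
    ... | t , t<c , eq = trans (cong walk (toℕ-fromℕ< t<c)) eq

    c≡n : suc c′ ≡ n
    c≡n with n ≤? suc c′
    ... | yes n≤c = ≤-antisym c≤n n≤c
    ... | no  n≰c with pigeonhole (≰⇒> n≰c) index
    ...   | i , j , i<j , eq = ⊥-elim (<-irrefl (cong toℕ i≡j) i<j)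
      where
      i≡j : i ≡ j
      i≡j = trans (sym (walk-index i)) (trans (cong (λ k → walk (toℕ k)) eq) (walk-index j))

    isCycle : IsCycle G
    isCycle = f , (f-injective , f-surjective) , λ i j → mk⇔ (to i j) (from i j)
      where
      f : Fin n → Fin n
      f i = walk (toℕ i)
      bound : ∀ (i : Fin n) → toℕ i < suc c′
      bound i = subst (toℕ i <_) (sym c≡n) (toℕ<n i)
      f-injective : ∀ {i j} → f i ≡ f j → i ≡ j
      f-injective {i} {j} eq = toℕ-injective (walk-injective (bound i) (bound j) eq)
      f-surjective : ∀ w → ∃ λ i → ∀ {j} → j ≡ i → f j ≡ w
      f-surjective w with on-walk w
      ... | t , t<c , eq = let t<n = subst (t <_) c≡n t<c in
                           fromℕ< t<n , λ { refl → trans (cong walk (toℕ-fromℕ< t<n)) eq }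
      step⇔ : ∀ (i j : Fin n) → CycleStep (toℕ i) (toℕ j) → CycSucc i j
      step⇔ i j (inj₁ eq)          = inj₁ eq
      step⇔ i j (inj₂ (eq₁ , eq₂)) = inj₂ (trans eq₁ c≡n , eq₂)
      step⇐ : ∀ (i j : Fin n) → CycSucc i j → CycleStep (toℕ i) (toℕ j)
      step⇐ i j (inj₁ eq)          = inj₁ eq
      step⇐ i j (inj₂ (eq₁ , eq₂)) = inj₂ (trans eq₁ (sym c≡n) , eq₂)
      to : ∀ i j → f i ~ f j → CycAdj i j
      to i j fi~fj with walk-neighbour (bound i) fi~fj
      ... | u , u<c , eq , steps with walk-injective u<c (bound j) eq
      ...   | refl = Data.Sum.map (step⇔ i j) (step⇔ j i) steps
      from : ∀ i j → CycAdj i j → f i ~ f j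
      from i j (inj₁ s) = cycleStep-adj (step⇐ i j s)
      from i j (inj₂ s) = ~-sym (cycleStep-adj (step⇐ j i s))

connected-two-regular⇒cycle : ∀ {n} (G : SimpleGraph n) → Connected G →
                              (∀ r → DegreeTwo (Adjacency._~_ G) r) → Fin n → IsCycle G
connected-two-regular⇒cycle G connected two-regular a₀ with TwoRegular.first-revisit G connected two-regular a₀
... | zero    , _   , (() , _) , _
... | suc c′ , c≤n , revisit , first =
  TwoRegular.FirstRevisit.isCycle G connected two-regular a₀ c′ c≤n revisit first

module Subdivided {n : ℕ} (G : SimpleGraph n) (q : ℕ) where
  open Adjacency G
  open ≡-Reasoning

  m : ℕ
  m = suc (suc q)

  Vertex : Set
  Vertex = V (Subdivision G m)

  infix 4 _—_
  _—_ : Vertex → Vertex → Set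
  _—_ = SubAdj G m

  —-sym : ∀ {x y} → x — y → y — x
  —-sym (orig () _)
  —-sym (startL p z) = startR p z
  —-sym (startR p z) = startL p z
  —-sym (endL p z)   = endR p z
  —-sym (endR p z)   = endL p z
  —-sym (inner p r s) = inner (sym p) (sym r) (Data.Sum.swap s)

  originals-nonadjacent : ∀ {a b} → ¬ inj₁ a — inj₁ b
  originals-nonadjacent (orig () _)

  -- The path replacing the edge u < v, from u (t = 0) to v (t = m); positions beyond m are junk.
  pos : Edge → ℕ → Vertex
  pos (u , v , p) zero = inj₁ u
  pos (u , v , p) (suc t) with t <ℕ? suc q
  ... | yes t<q+1 = inj₂ (u , v , p , fromℕ< t<q+1)
  ... | no  _     = inj₁ v

  along : Arc → ℕ → Vertex
  along (e , true)  t = pos e t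
  along (e , false) t = pos e (m ∸ t)

  arcOf : Internal G m → Arc
  arcOf (u , v , p , _) = (u , v , p) , true

  ii<q+1 : ∀ x → ii G m x < suc q
  ii<q+1 (_ , _ , _ , i) = toℕ<n i

  along-end : ∀ O → along O m ≡ inj₁ (end O)
  along-end ((u , v , p) , true) with suc q <ℕ? suc q
  ... | yes q+1<q+1 = ⊥-elim (<-irrefl refl q+1<q+1)
  ... | no  _       = refl
  along-end (e , false) = cong (pos e) (n∸n≡0 m)

  along-start : ∀ O → along O 0 ≡ inj₁ (start O)
  along-start (e , true)  = refl
  along-start (e , false) = along-end (e , true)

  along-flip : ∀ O {t} → t ≤ m → along (flip O) t ≡ along O (m ∸ t)
  along-flip (e , true)  _   = refl
  along-flip (e , false) t≤m = cong (pos e) (sym (m∸[m∸n]≡n t≤m))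

  along-internal : ∀ x → along (arcOf x) (suc (ii G m x)) ≡ inj₂ x
  along-internal (u , v , p , i) with toℕ i <ℕ? suc q
  ... | yes i<q+1 = cong (λ j → inj₂ (u , v , p , j)) (fromℕ<-toℕ i i<q+1)
  ... | no  i≮q+1 = ⊥-elim (i≮q+1 (toℕ<n i))

  pos-interior : ∀ u v p {t} (t<q+1 : t < suc q) → pos (u , v , p) (suc t) ≡ inj₂ (u , v , p , fromℕ< t<q+1)
  pos-interior u v p {t} t<q+1 with t <ℕ? suc q
  ... | yes t<q+1′ = cong (λ l → inj₂ (u , v , p , fromℕ< l)) (<-irrelevant t<q+1′ t<q+1)
  ... | no  t≮q+1  = ⊥-elim (t≮q+1 t<q+1)

  pos-adj : ∀ e {t} → t < m → pos e t — pos e (suc t)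
  pos-adj (u , v , p) {zero} _ = subst (inj₁ u —_) (sym (pos-interior u v p (s≤s z≤n))) (startL refl refl)
  pos-adj (u , v , p) {suc t} (s≤s t<q+1) with t <ℕ? suc q | suc t <ℕ? suc q
  ... | yes t<  | yes t+1< = inner refl refl (inj₁ (trans (cong suc (toℕ-fromℕ< t<)) (sym (toℕ-fromℕ< t+1<))))
  ... | yes t<  | no  t+1≮ = endR refl (trans (cong suc (toℕ-fromℕ< t<)) (≤-antisym t<q+1 (≤-pred (≰⇒> t+1≮))))
  ... | no  t≮  | _        = ⊥-elim (t≮ t<q+1)

  along-adj : ∀ O {t} → t < m → along O t — along O (suc t)
  along-adj (e , true)  t<m = pos-adj e t<m
  along-adj (e , false) {t} t<m rewrite ∸-suc t<m =
    —-sym (pos-adj e (subst (_≤ m) (∸-suc t<m) (m∸n≤m m t)))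

  position : Edge → Vertex → ℕ
  position (u , _ , _) (inj₁ w) with w ≟ u
  ... | yes _ = 0
  ... | no  _ = m
  position _ (inj₂ x) = suc (ii G m x)

  position-pos : ∀ e {t} → t ≤ m → position e (pos e t) ≡ t
  position-pos (u , v , p) {zero} _ with u ≟ u
  ... | yes _   = refl
  ... | no  u≢u = ⊥-elim (u≢u refl)
  position-pos (u , v , _ , u<v) {suc t} t<m with t <ℕ? suc q
  ... | yes t<q+1 = cong suc (toℕ-fromℕ< t<q+1)
  ... | no  t≮q+1 with v ≟ u
  ...   | yes v≡u = ⊥-elim (<-irrefl (cong toℕ (sym v≡u)) u<v)
  ...   | no  _   = ≤-antisym (≰⇒> t≮q+1) t<m

  along-injective : ∀ O {t t′} → t ≤ m → t′ ≤ m → along O t ≡ along O t′ → t ≡ t′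
  along-injective (e , true) {t} {t′} t≤m t′≤m eq =
    trans (sym (position-pos e t≤m)) (trans (cong (position e) eq) (position-pos e t′≤m))
  along-injective (e , false) {t} {t′} t≤m t′≤m eq =
    ∸-cancelˡ-≡ t≤m t′≤m (along-injective (e , true) (m∸n≤m m t) (m∸n≤m m t′) eq)

  along-sibling : ∀ x y → iu G m x ≡ iu G m y → iv G m x ≡ iv G m y → along (arcOf x) (suc (ii G m y)) ≡ inj₂ y
  along-sibling x y u≡u′ v≡v′ =
    trans (cong (λ O → along O (suc (ii G m y))) (Arc-≡ (arcOf x) (arcOf y) u≡u′ v≡v′)) (along-internal y)

  internal-neighbours : ∀ x {z} → inj₂ x — z →
                        z ≡ along (arcOf x) (ii G m x) ⊎ z ≡ along (arcOf x) (suc (suc (ii G m x)))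
  internal-neighbours (u , v , p , i) (startR refl i≡0) = inj₁ (cong (pos (u , v , p)) (sym i≡0))
  internal-neighbours (u , v , p , i) (endR refl i+1≡q+1) =
    inj₂ (sym (trans (cong (λ t → pos (u , v , p) (suc t)) i+1≡q+1) (along-end ((u , v , p) , true))))
  internal-neighbours x {inj₂ y} (inner u≡u′ v≡v′ (inj₁ x+1≡y)) =
    inj₂ (sym (trans (cong (λ t → along (arcOf x) (suc t)) x+1≡y) (along-sibling x y u≡u′ v≡v′)))
  internal-neighbours x {inj₂ y} (inner u≡u′ v≡v′ (inj₂ y+1≡x)) =
    inj₁ (sym (trans (cong (along (arcOf x)) (sym y+1≡x)) (along-sibling x y u≡u′ v≡v′)))

  pos-neighbours : ∀ e {t z} → t < suc q → pos e (suc t) — z → z ≡ pos e t ⊎ z ≡ pos e (suc (suc t))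
  pos-neighbours e@(u , v , p) {t} {z} t<q+1 e~z
    with internal-neighbours _ (subst (_— z) (pos-interior u v p t<q+1) e~z)
  ... | inj₁ eq = inj₁ (subst (λ s → _ ≡ pos e s) (toℕ-fromℕ< t<q+1) eq)
  ... | inj₂ eq = inj₂ (subst (λ s → _ ≡ pos e (suc (suc s))) (toℕ-fromℕ< t<q+1) eq)

  along-neighbours : ∀ O {t z} → suc t < m → along O (suc t) — z → z ≡ along O t ⊎ z ≡ along O (suc (suc t))
  along-neighbours (e , true) (s≤s t<q+1) = pos-neighbours e t<q+1
  along-neighbours (e , false) {t} {z} t+1<m e~z
    with pos-neighbours e (s≤s (m∸n≤m q t)) (subst (λ s → pos e s — z) (∸-suc t+1<m) e~z)
  ... | inj₁ eq = inj₂ eq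
  ... | inj₂ eq = inj₁ (trans eq (cong (pos e) (sym (trans (∸-suc (<⇒≤ t+1<m)) (cong suc (∸-suc t+1<m))))))

  along-interior : ∀ O {t} → t < suc q → ∃ λ x → along O (suc t) ≡ inj₂ x
  along-interior ((u , v , p) , true)  t<q+1 = _ , pos-interior u v p t<q+1
  along-interior ((u , v , p) , false) {t} t<q+1 =
    _ , trans (cong (pos (u , v , p)) (∸-suc t<q+1)) (pos-interior u v p (s≤s (m∸n≤m q t)))

  original-neighbour : ∀ {a y} → inj₁ a — y → Σ[ O ∈ Arc ] start O ≡ a × along O 1 ≡ y
  original-neighbour {y = inj₂ x} (startL a≡u i≡0) =
    arcOf x , sym a≡u , subst (λ t → along (arcOf x) (suc t) ≡ inj₂ x) i≡0 (along-internal x)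
  original-neighbour {y = inj₂ x} (endL a≡v i+1≡q+1) =
    flip (arcOf x) , sym a≡v , subst (λ t → along (arcOf x) t ≡ inj₂ x) i+1≡q+1 (along-internal x)

  Consecutive : Vertex → Vertex → Set
  Consecutive x y = Σ[ O ∈ Arc ] Σ[ t ∈ ℕ ] t < m × x ≡ along O t × y ≡ along O (suc t)

  consecutive-swap : ∀ {x y} → Consecutive x y → Consecutive y x
  consecutive-swap (O , t , t<m , refl , refl) =
    flip O , m ∸ suc t , m∸[t+1]<m ,
    trans (sym (cong (along O) (m∸[m∸n]≡n t<m))) (sym (along-flip O (m∸n≤m m (suc t)))) ,
    trans (sym (cong (along O) (m∸[m∸n]≡n (<⇒≤ t<m))))
          (trans (sym (along-flip O (m∸n≤m m t))) (cong (along (flip O)) (∸-suc t<m)))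
    where
    m∸[t+1]<m : m ∸ suc t < m
    m∸[t+1]<m = subst (_≤ m) (∸-suc t<m) (m∸n≤m m t)

  —⇒consecutive : ∀ {x y} → x — y → Consecutive x y
  —⇒consecutive {inj₁ _} a—y with original-neighbour a—y
  ... | O , refl , y≡ = O , 0 , s≤s z≤n , sym (along-start O) , sym y≡
  —⇒consecutive {inj₂ x} x—y with internal-neighbours x x—y
  ... | inj₁ y≡ = consecutive-swap (arcOf x , ii G m x , ≤-trans (ii<q+1 x) (n≤1+n _) ,
                                    y≡ , sym (along-internal x))
  ... | inj₂ y≡ = arcOf x , suc (ii G m x) , s≤s (ii<q+1 x) , sym (along-internal x) , y≡

  follows-arc : ∀ (f : ℕ → Vertex) O → f 0 ≡ along O 0 → f 1 ≡ along O 1 →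
                (∀ t → suc t < m → f (suc t) — f (suc (suc t))) →
                (∀ t → suc t < m → f (suc (suc t)) ≢ f t) →
                ∀ t → t ≤ m → f t ≡ along O t
  follows-arc f O f₀ f₁ f-adj f-nonbacktracking = λ
    { zero    _     → f₀
    ; (suc t) t+1≤m → proj₂ (two-steps t t+1≤m) }
    where
    two-steps : ∀ t → suc t ≤ m → f t ≡ along O t × f (suc t) ≡ along O (suc t)
    two-steps zero    _ = f₀ , f₁
    two-steps (suc t) t+2≤m with two-steps t (<⇒≤ t+2≤m)
    ... | fₜ , fₜ₊₁ with along-neighbours O t+2≤m (subst (_— f (suc (suc t))) fₜ₊₁ (f-adj t t+2≤m))
    ...   | inj₁ eq = ⊥-elim (f-nonbacktracking t t+2≤m (trans eq (sym fₜ)))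
    ...   | inj₂ eq = fₜ₊₁ , eq

  along-nonbacktracking : ∀ O t → suc t < m → along O (suc (suc t)) ≢ along O t
  along-nonbacktracking O t t+1<m eq =
    m≢1+n+m t {1} (sym (along-injective O t+1<m (≤-trans (n≤1+n t) (<⇒≤ t+1<m)) eq))

  arc-unique : ∀ O O′ → start O ≡ start O′ → along O 1 ≡ along O′ 1 → O ≡ O′
  arc-unique O O′ starts seconds = Arc-≡ O O′ starts (inj₁-injective ends)
    where
    along-O′ : ∀ t → t ≤ m → along O′ t ≡ along O t
    along-O′ = follows-arc (along O′) O
      (trans (along-start O′) (sym (trans (along-start O) (cong inj₁ starts))))
      (sym seconds) (λ t → along-adj O′) (along-nonbacktracking O′)
    ends : inj₁ (end O) ≡ inj₁ (end O′)
    ends = trans (sym (along-end O)) (trans (sym (along-O′ m ≤-refl)) (along-end O′))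

  internal-degree-two : ∀ x → DegreeTwo _—_ (inj₂ x)
  internal-degree-two x = record
    { nb₁        = along O i
    ; nb₂        = along O (suc (suc i))
    ; nb₁≢nb₂    = λ eq → along-nonbacktracking O i (s≤s i<q+1) (sym eq)
    ; ~nb₁       = subst (_— along O i) (along-internal x) (—-sym (along-adj O (≤-trans i<q+1 (n≤1+n _))))
    ; ~nb₂       = subst (_— along O (suc (suc i))) (along-internal x) (along-adj O (s≤s i<q+1))
    ; neighbours = λ _ → internal-neighbours x
    }
    where
    O : Arc
    O = arcOf x
    i : ℕ
    i = ii G m x
    i<q+1 : i < suc q
    i<q+1 = ii<q+1 x

  original-degree-two : ∀ r → DegreeTwo _—_ (inj₁ r) → DegreeTwo _~_ r
  original-degree-two r deg
    with original-neighbour (DegreeTwo.~nb₁ deg) | original-neighbour (DegreeTwo.~nb₂ deg)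
  ... | O₁ , start₁ , second₁ | O₂ , start₂ , second₂ = record
    { nb₁        = end O₁
    ; nb₂        = end O₂
    ; nb₁≢nb₂    = λ eq → nb₁≢nb₂ (trans (sym second₁)
                     (trans (cong (λ O → along O 1) (Arc-≡ O₁ O₂ (trans start₁ (sym start₂)) eq)) second₂))
    ; ~nb₁       = subst (_~ end O₁) start₁ (start~end O₁)
    ; ~nb₂       = subst (_~ end O₂) start₂ (start~end O₂)
    ; neighbours = λ w r~w → Data.Sum.map (end-of r~w O₁ start₁ second₁) (end-of r~w O₂ start₂ second₂)
                                          (neighbours (along (orient r w r~w) 1) (r—second r~w))
    }
    where
    open DegreeTwo deg
    r—second : ∀ {w} (r~w : r ~ w) → inj₁ r — along (orient r w r~w) 1
    r—second {w} r~w =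
      subst (_— along O 1) (trans (along-start O) (cong inj₁ (orient-start r w r~w))) (along-adj O (s≤s z≤n))
      where
      O : Arc
      O = orient r w r~w
    end-of : ∀ {w} (r~w : r ~ w) Oᵢ {y} → start Oᵢ ≡ r → along Oᵢ 1 ≡ y → along (orient r w r~w) 1 ≡ y →
             w ≡ end Oᵢ
    end-of {w} r~w Oᵢ startᵢ secondᵢ eq =
      trans (sym (orient-end r w r~w))
            (cong end (arc-unique (orient r w r~w) Oᵢ (trans (orient-start r w r~w) (sym startᵢ)) (trans eq (sym secondᵢ))))

  module Lift (π : Fin n → Fin n) (π-adj : ∀ {a b} → a ~ b → π a ~ π b) where

    liftArc : Arc → Arc
    liftArc O = orient (π (start O)) (π (end O)) (π-adj (start~end O))

    liftArc-≡ : ∀ O O′ → π (start O) ≡ start O′ → π (end O) ≡ end O′ → liftArc O ≡ O′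
    liftArc-≡ O O′ starts ends = Arc-≡ (liftArc O) O′
      (trans (orient-start _ _ (π-adj (start~end O))) starts)
      (trans (orient-end _ _ (π-adj (start~end O))) ends)

    lift : Vertex → Vertex
    lift (inj₁ w) = inj₁ (π w)
    lift (inj₂ x) = along (liftArc (arcOf x)) (suc (ii G m x))

    lift-pos : ∀ e {t} → t ≤ m → lift (pos e t) ≡ along (liftArc (e , true)) t
    lift-pos e {zero} _ =
      sym (trans (along-start (liftArc (e , true))) (cong inj₁ (orient-start _ _ (π-adj (start~end (e , true))))))
    lift-pos (u , v , p) {suc t} t+1≤m with t <ℕ? suc q
    ... | yes t<q+1 = cong (λ s → along (liftArc ((u , v , p) , true)) (suc s)) (toℕ-fromℕ< t<q+1)
    ... | no  t≮q+1 = sym (trans (cong (along O′) t+1≡m)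
                                 (trans (along-end O′) (cong inj₁ (orient-end _ _ (π-adj (proj₁ p))))))
      where
      O′ : Arc
      O′ = liftArc ((u , v , p) , true)
      t+1≡m : suc t ≡ m
      t+1≡m = cong suc (≤-antisym (≤-pred t+1≤m) (≤-pred (≰⇒> t≮q+1)))

    lift-along : ∀ O {t} → t ≤ m → lift (along O t) ≡ along (liftArc O) t
    lift-along (e , true)  = lift-pos e
    lift-along (e , false) {t} t≤m = begin
      lift (pos e (m ∸ t))                 ≡⟨ lift-pos e (m∸n≤m m t) ⟩
      along (liftArc (e , true)) (m ∸ t)   ≡⟨ along-flip (liftArc (e , true)) t≤m ⟨
      along (flip (liftArc (e , true))) t  ≡⟨ cong (λ O → along O t) liftArc-flip ⟨
      along (liftArc (e , false)) t        ∎
      where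
      liftArc-flip : liftArc (e , false) ≡ flip (liftArc (e , true))
      liftArc-flip = liftArc-≡ (e , false) (flip (liftArc (e , true)))
        (sym (trans (start-flip (liftArc (e , true))) (orient-end _ _ (π-adj (start~end (e , true))))))
        (sym (trans (end-flip (liftArc (e , true))) (orient-start _ _ (π-adj (start~end (e , true))))))

    lift-adj : ∀ {x y} → x — y → lift x — lift y
    lift-adj x—y with —⇒consecutive x—y
    ... | O , t , t<m , refl , refl =
      subst₂ _—_ (sym (lift-along O (<⇒≤ t<m))) (sym (lift-along O t<m)) (along-adj (liftArc O) t<m)

    lift-identity : (∀ w → π w ≡ w) → ∀ x → lift x ≡ x
    lift-identity π≗id (inj₁ w) = cong inj₁ (π≗id w)
    lift-identity π≗id (inj₂ x) =
      trans (cong (λ O → along O (suc (ii G m x))) (liftArc-≡ (arcOf x) (arcOf x) (π≗id _) (π≗id _)))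
            (along-internal x)

  lift-inverse : ∀ π (π-adj : ∀ {a b} → a ~ b → π a ~ π b) ρ (ρ-adj : ∀ {a b} → a ~ b → ρ a ~ ρ b) →
                 (∀ w → ρ (π w) ≡ w) → ∀ x → Lift.lift ρ ρ-adj (Lift.lift π π-adj x) ≡ x
  lift-inverse π π-adj ρ ρ-adj ρ∘π (inj₁ w) = cong inj₁ (ρ∘π w)
  lift-inverse π π-adj ρ ρ-adj ρ∘π (inj₂ x) = begin
    R.lift (along (P.liftArc O) (suc i))   ≡⟨ R.lift-along (P.liftArc O) (s≤s (<⇒≤ (ii<q+1 x))) ⟩
    along (R.liftArc (P.liftArc O)) (suc i) ≡⟨ cong (λ O′ → along O′ (suc i)) back ⟩
    along O (suc i)                         ≡⟨ along-internal x ⟩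
    inj₂ x                                  ∎
    where
    module P = Lift π π-adj
    module R = Lift ρ ρ-adj
    O : Arc
    O = arcOf x
    i : ℕ
    i = ii G m x
    back : R.liftArc (P.liftArc O) ≡ O
    back = R.liftArc-≡ (P.liftArc O) O
      (trans (cong ρ (orient-start _ _ (π-adj (start~end O)))) (ρ∘π _))
      (trans (cong ρ (orient-end _ _ (π-adj (start~end O)))) (ρ∘π _))

  induced : Automorphism G → Vertex → Vertex
  induced A = Lift.lift (Automorphism.to A) (Automorphism.to-adj A)

  induced-automorphism : (A : Automorphism G) → IsAut (Subdivision G m) (induced A)
  induced-automorphism A =
    (injective , λ y → F.lift y , λ { refl → lift-inverse from from-adj to to-adj to∘from y }) ,
    λ x y → mk⇔ lift-adj (λ σx—σy → subst₂ _—_ (from-to x) (from-to y) (F.lift-adj σx—σy))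
    where
    open Automorphism A
    open Lift to to-adj
    module F = Lift from from-adj
    from-to : ∀ x → F.lift (lift x) ≡ x
    from-to = lift-inverse to to-adj from from-adj from∘to
    injective : ∀ {x y} → lift x ≡ lift y → x ≡ y
    injective {x} {y} eq = trans (sym (from-to x)) (trans (cong F.lift eq) (from-to y))

  IsOriginal : Vertex → Set
  IsOriginal x = ∃ λ a → x ≡ inj₁ a

  original? : ∀ x → Dec (IsOriginal x)
  original? (inj₁ a) = yes (a , refl)
  original? (inj₂ x) = no λ ()

  non-original-degree-two : ∀ x → ¬ IsOriginal x → DegreeTwo _—_ x
  non-original-degree-two (inj₁ a) ¬original = ⊥-elim (¬original (a , refl))
  non-original-degree-two (inj₂ x) _         = internal-degree-two x

  module Embedding (σ : Vertex → Vertex) (σ-injective : ∀ {x y} → σ x ≡ σ y → x ≡ y)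
                   (σ-adj : ∀ {x y} → x — y → σ x — σ y) where

    ArcImage : Arc → Fin n → Set
    ArcImage O a = Σ[ O′ ∈ Arc ] start O′ ≡ a × σ (inj₁ (end O)) ≡ inj₁ (end O′) ×
                                 (∀ t → t ≤ m → σ (along O t) ≡ along O′ t)

    arc-image : ∀ O {a} → σ (inj₁ (start O)) ≡ inj₁ a → ArcImage O a
    arc-image O {a} σ-start = image (original-neighbour σ-start—σ-second)
      where
      σ-along₀ : σ (along O 0) ≡ inj₁ a
      σ-along₀ = trans (cong σ (along-start O)) σ-start
      σ-start—σ-second : inj₁ a — σ (along O 1)
      σ-start—σ-second = subst (_— σ (along O 1)) σ-along₀ (σ-adj (along-adj O (s≤s z≤n)))
      image : Σ[ O′ ∈ Arc ] start O′ ≡ a × along O′ 1 ≡ σ (along O 1) → ArcImage O a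
      image (O′ , start′ , second′) = O′ , start′ , σ-end , σ-along
        where
        σ-along : ∀ t → t ≤ m → σ (along O t) ≡ along O′ t
        σ-along = follows-arc (λ t → σ (along O t)) O′
          (trans σ-along₀ (sym (trans (along-start O′) (cong inj₁ start′))))
          (sym second′)
          (λ t t+1<m → σ-adj (along-adj O t+1<m))
          (λ t t+1<m eq → along-nonbacktracking O t t+1<m (σ-injective eq))
        σ-end : σ (inj₁ (end O)) ≡ inj₁ (end O′)
        σ-end = trans (cong σ (sym (along-end O))) (trans (σ-along m ≤-refl) (along-end O′))

    originals-preserved : Connected G → ∀ {r} → IsOriginal (σ (inj₁ r)) → ∀ w → IsOriginal (σ (inj₁ w))
    originals-preserved connected {r} σr w = follow (connected r w) σr
      where
      follow : ∀ {u w} → Walk G u w → IsOriginal (σ (inj₁ u)) → IsOriginal (σ (inj₁ w))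
      follow here                  σu       = σu
      follow (step {u} {v} u~v walk) (a , σu)
        with arc-image (orient u v u~v) (trans (cong (λ b → σ (inj₁ b)) (orient-start u v u~v)) σu)
      ... | O′ , _ , σ-end , _ =
        follow walk (end O′ , trans (cong (λ b → σ (inj₁ b)) (sym (orient-end u v u~v))) σ-end)

    module OriginalPreserving (σ-original : ∀ w → IsOriginal (σ (inj₁ w))) where

      π : Fin n → Fin n
      π w = proj₁ (σ-original w)

      σ-inj₁ : ∀ w → σ (inj₁ w) ≡ inj₁ (π w)
      σ-inj₁ w = proj₂ (σ-original w)

      image : ∀ O → Σ[ O′ ∈ Arc ] π (start O) ≡ start O′ × π (end O) ≡ end O′ ×
                                  (∀ t → t ≤ m → σ (along O t) ≡ along O′ t)
      image O with arc-image O (σ-inj₁ (start O))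
      ... | O′ , start′ , σ-end , σ-along =
        O′ , sym start′ , inj₁-injective (trans (sym (σ-inj₁ (end O))) σ-end) , σ-along

      π-adj : ∀ {a b} → a ~ b → π a ~ π b
      π-adj {a} {b} a~b with image (orient a b a~b)
      ... | O′ , start′ , end′ , _ =
        subst₂ _~_ (trans (sym start′) (cong π (orient-start a b a~b)))
                   (trans (sym end′) (cong π (orient-end a b a~b))) (start~end O′)

      open Lift π π-adj public

      σ≗lift : ∀ x → σ x ≡ lift x
      σ≗lift (inj₁ w) = σ-inj₁ w
      σ≗lift (inj₂ x) with image (arcOf x)
      ... | O′ , start′ , end′ , σ-along = begin
        σ (inj₂ x)                            ≡⟨ cong σ (along-internal x) ⟨
        σ (along (arcOf x) (suc i))           ≡⟨ σ-along (suc i) (s≤s (<⇒≤ (ii<q+1 x))) ⟩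
        along O′ (suc i)                      ≡⟨ cong (λ O → along O (suc i)) (liftArc-≡ (arcOf x) O′ start′ end′) ⟨
        along (liftArc (arcOf x)) (suc i)     ∎
        where
        i : ℕ
        i = ii G m x

  induced-by-automorphism : Connected G → ∀ {σ} → IsAut (Subdivision G m) σ → ∀ {r} → IsOriginal (σ (inj₁ r)) →
                            Σ[ A ∈ Automorphism G ] (∀ x → σ x ≡ induced A x)
  induced-by-automorphism connected {σ} ((σ-injective , σ-surjective) , σ-adj) σr = A , S.σ≗lift
    where
    module S = Embedding.OriginalPreserving σ σ-injective (Equivalence.to (σ-adj _ _))
                 (Embedding.originals-preserved σ σ-injective (Equivalence.to (σ-adj _ _)) connected σr)
    σ⁻¹ : Vertex → Vertex
    σ⁻¹ y = proj₁ (σ-surjective y)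
    σσ⁻¹ : ∀ y → σ (σ⁻¹ y) ≡ y
    σσ⁻¹ y = proj₂ (σ-surjective y) refl
    σ⁻¹-injective : ∀ {x y} → σ⁻¹ x ≡ σ⁻¹ y → x ≡ y
    σ⁻¹-injective {x} {y} eq = trans (sym (σσ⁻¹ x)) (trans (cong σ eq) (σσ⁻¹ y))
    σ⁻¹-adj : ∀ {x y} → x — y → σ⁻¹ x — σ⁻¹ y
    σ⁻¹-adj x—y = Equivalence.from (σ-adj _ _) (subst₂ _—_ (sym (σσ⁻¹ _)) (sym (σσ⁻¹ _)) x—y)
    σ⁻¹-original : ∀ w → IsOriginal (σ⁻¹ (inj₁ w))
    σ⁻¹-original w with σ⁻¹ (inj₁ w) | σσ⁻¹ (inj₁ w)
    ... | inj₁ a | _     = a , refl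
    ... | inj₂ x | σx≡w with along-interior (S.liftArc (arcOf x)) (ii<q+1 x)
    ...   | _ , internal with () ← trans (sym σx≡w) (trans (S.σ≗lift (inj₂ x)) internal)
    module R = Embedding.OriginalPreserving σ⁻¹ σ⁻¹-injective σ⁻¹-adj σ⁻¹-original
    A : Automorphism G
    A = record
      { to       = S.π
      ; from     = R.π
      ; to-adj   = S.π-adj
      ; from-adj = R.π-adj
      ; from∘to  = λ w → inj₁-injective (trans (sym (R.σ-inj₁ (S.π w)))
                                         (trans (cong σ⁻¹ (sym (S.σ-inj₁ w))) (σ-injective (σσ⁻¹ (σ (inj₁ w))))))
      ; to∘from  = λ w → inj₁-injective (trans (sym (S.σ-inj₁ (R.π w)))
                                         (trans (cong σ (sym (R.σ-inj₁ w))) (σσ⁻¹ (inj₁ w))))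
      }

-- S₁ is G^{1/k} and S₂ is G^{1/(k+1)}, for k = p + 2.
module EdgeToVertexLabeling {n : ℕ} (G : SimpleGraph n) (p : ℕ) {d : ℕ}
         (ℓ : V (Subdivision G (suc (suc p))) → V (Subdivision G (suc (suc p))) → Fin d)
         (ℓ-edge : IsEdgeLabeling (Subdivision G (suc (suc p))) d ℓ) (c : Fin d) where
  open Adjacency G
  open ≡-Reasoning
  module S₁ = Subdivided G p
  module S₂ = Subdivided G (suc p)

  -- Original vertices share the arbitrary colour c; the argument never needs them to differ.
  label : S₂.Vertex → Fin d
  label (inj₁ _) = c
  label (inj₂ x) = ℓ (S₁.along (S₂.arcOf x) (ii G S₂.m x)) (S₁.along (S₂.arcOf x) (suc (ii G S₂.m x)))

  label-along : ∀ O {t} → t < S₁.m → label (S₂.along O (suc t)) ≡ ℓ (S₁.along O t) (S₁.along O (suc t))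
  label-along (e@(u , v , p) , true) {t} t<m = begin
    label (S₂.pos e (suc t))
      ≡⟨ cong label (S₂.pos-interior u v p t<m) ⟩
    ℓ (S₁.pos e (toℕ i)) (S₁.pos e (suc (toℕ i)))
      ≡⟨ cong (λ s → ℓ (S₁.pos e s) (S₁.pos e (suc s))) (toℕ-fromℕ< t<m) ⟩
    ℓ (S₁.pos e t) (S₁.pos e (suc t))
      ∎
    where
    i : Fin S₁.m
    i = fromℕ< t<m
  label-along (e , false) {t} t<m = begin
    label (S₂.pos e (S₁.m ∸ t))
      ≡⟨ cong (λ s → label (S₂.pos e s)) (∸-suc t<m) ⟩
    label (S₂.pos e (suc (S₁.m ∸ suc t)))
      ≡⟨ label-along (e , true) (subst (_≤ S₁.m) (∸-suc t<m) (m∸n≤m S₁.m t)) ⟩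
    ℓ (S₁.pos e (S₁.m ∸ suc t)) (S₁.pos e (suc (S₁.m ∸ suc t)))
      ≡⟨ cong (λ s → ℓ (S₁.pos e (S₁.m ∸ suc t)) (S₁.pos e s)) (∸-suc t<m) ⟨
    ℓ (S₁.along (e , false) (suc t)) (S₁.along (e , false) t)
      ≡⟨ ℓ-edge _ _ (S₁.along-adj (e , false) t<m) ⟨
    ℓ (S₁.along (e , false) t) (S₁.along (e , false) (suc t))
      ∎

  induced-preserves-ℓ : ∀ A → (∀ x → label (S₂.induced A x) ≡ label x) →
                        ∀ x y → x S₁.— y → ℓ (S₁.induced A x) (S₁.induced A y) ≡ ℓ x y
  induced-preserves-ℓ A preserves x y x—y with S₁.—⇒consecutive x—y
  ... | O , t , t<m , refl , refl = begin
    ℓ (S₁.induced A (S₁.along O t)) (S₁.induced A (S₁.along O (suc t)))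
      ≡⟨ cong₂ ℓ (L₁.lift-along O (<⇒≤ t<m)) (L₁.lift-along O t<m) ⟩
    ℓ (S₁.along O′ t) (S₁.along O′ (suc t))           ≡⟨ label-along O′ t<m ⟨
    label (S₂.along O′ (suc t))                       ≡⟨ cong label (L₂.lift-along O (s≤s (<⇒≤ t<m))) ⟨
    label (S₂.induced A (S₂.along O (suc t)))         ≡⟨ preserves (S₂.along O (suc t)) ⟩
    label (S₂.along O (suc t))                        ≡⟨ label-along O t<m ⟩
    ℓ (S₁.along O t) (S₁.along O (suc t))             ∎
    where
    open Automorphism A
    module L₁ = S₁.Lift to to-adj
    module L₂ = S₂.Lift to to-adj
    O′ : Arc
    O′ = L₁.liftArc O

  label-distinguishing : Connected G → ¬ IsCycle G → Fin n →
                         IsDistEdgeLabeling (Subdivision G S₁.m) d ℓ →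
                         IsDistVertexLabeling (Subdivision G S₂.m) d label
  label-distinguishing connected ¬cycle a₀ (_ , ℓ-distinguishing) σ σ-aut σ-preserves
    with any? (λ r → S₂.original? (σ (inj₁ r)))
  ... | no none = ⊥-elim (¬cycle (connected-two-regular⇒cycle G connected two-regular a₀))
    where
    two-regular : ∀ r → DegreeTwo _~_ r
    two-regular r = S₂.original-degree-two r (DegreeTwo-reflect (Subdivision G S₂.m) σ-aut (inj₁ r)
                      (S₂.non-original-degree-two (σ (inj₁ r)) (λ σr → none (r , σr))))
  ... | yes (r , σr) with S₂.induced-by-automorphism connected σ-aut σr
  ...   | A , σ≗induced = λ x → trans (σ≗induced x) (S₂.Lift.lift-identity to to-adj to≗id x)
    where
    open Automorphism A
    induced-preserves-label : ∀ x → label (S₂.induced A x) ≡ label x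
    induced-preserves-label x = trans (cong label (sym (σ≗induced x))) (σ-preserves x)
    to≗id : ∀ w → to w ≡ w
    to≗id w = inj₁-injective (ℓ-distinguishing (S₁.induced A) (S₁.induced-automorphism A)
                                (induced-preserves-ℓ A induced-preserves-label) (inj₁ w))

theorem4p1 : ∀ (n : ℕ) (G : SimpleGraph n) → 3 ≤ n → Connected G → ¬ IsCycle G →
    ∀ (k : ℕ) → 2 ≤ k → ∀ (d d′ : ℕ) →
    IsDistinguishingNumber (Subdivision G (suc k)) d →
    IsDistinguishingIndex (Subdivision G k) d′ →
    d ≤ d′
theorem4p1 n G 3≤n connected ¬cycle (suc (suc p)) (s≤s (s≤s z≤n)) d d′ (_ , minimal)
           ((ℓ , ℓ-distinguishing) , _) =
  minimal d′ (label , label-distinguishing connected ¬cycle a₀ ℓ-distinguishing)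
  where
  a₀ : Fin n
  a₀ = fromℕ< (≤-trans (s≤s z≤n) 3≤n)
  open EdgeToVertexLabeling G p ℓ (proj₁ ℓ-distinguishing) (ℓ (inj₁ a₀) (inj₁ a₀))
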